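{- Let $Q$ be finite, $\rho:Q\to\mathbb{N}$ with maximum $m$, and $\mathcal{D}^k$ etc. as in the context. For every $0<k\le m$, every type $A$ and every $d\in\mathcal{D}^k_A$, letting $\widetilde{d}=(\top^{k-1}_A)^{\uparrow\bot}\vee\overline{d}$, we have $d=(d^\downarrow)^{\uparrow\bot}\vee\overline{d}$ and $d=(d^\downarrow)^{\uparrow\top}\wedge\widetilde{d}$.
   Context: $Q_k=\{q:\rho(q)=k\}$, $Q_{\le k}=\{q:\rho(q)\le k\}$. $\mathcal{D}^0_o=\mathcal{P}(Q_0)$, $\mathcal{D}^0_{A\to B}$ = monotone maps $\mathcal{D}^0_A\to\mathcal{D}^0_B$; for $k>0$: $\mathcal{D}^k_o=\mathcal{P}(Q_{\le k})$, $\mathcal{L}^k_o=\{(R,P): R=P\cap Q_{\le k-1}\}$, $\mathcal{L}^k_{A\to B}=\{(f_1,f_2): f_1\in\mathcal{D}^{k-1}_{A\to B}$, $f_2$ monotone $\mathcal{D}^k_A\to\mathcal{D}^k_B$, $(f_1(g_1),f_2(g_2))\in\mathcal{L}^k_B$ whenever $(g_1,g_2)\in\mathcal{L}^k_A\}$, $\mathcal{D}^k_{A\to B}=\{f_2:\exists f_1,(f_1,f_2)\in\mathcal{L}^k_{A\to B}\}$; order is inclusion at $o$ and pointwise at arrows (so joins/meets are pointwise). $\top^k_A$ is the greatest element of $\mathcal{D}^k_A$. $e^\downarrow$ is the unique $d$ with $(d,e)\in\mathcal{L}^k_A$; $d^{\uparrow\top}$, $d^{\uparrow\bot}$ are the greatest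 and least $e\in\mathcal{D}^k_A$ with $(d,e)\in\mathcal{L}^k_A$. The operation $\overline{\cdot}$ on $\mathcal{D}^k_A$ is defined by: $\overline{d}=d\cap Q_k$ if $A=o$, and $\overline{d}(e)=\overline{d(e)}$ for $e\in\mathcal{D}^k_B$ if $A=B\to C$. -}

module Defs where

open import Data.Nat using (ℕ; zero; suc; _≤ᵇ_; _≡ᵇ_; _≤_)
open import Data.Fin using (Fin)
open import Data.Fin.Subset using (Subset; _⊆_; _∪_; _∩_)
open import Data.Vec using (tabulate)
open import Data.Product using (Σ; _×_; ∃)
open import Relation.Binary.PropositionalEquality using (_≡_)

data Ty : Set where
  o   : Ty
  _⇒_ : Ty → Ty → Ty

infixr 5 _⇒_

-- The finite set Q is Fin n.
-- Membership in D^k_A is the predicate 'D' below; only the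
-- behaviour of functions on the relevant domains D^k matters
-- (the order/equality are pointwise on D^k_A).
Val : ℕ → Ty → Set
Val n o       = Subset n
Val n (A ⇒ B) = Val n A → Val n B

IsMax : {n : ℕ} → (Fin n → ℕ) → ℕ → Set
IsMax ρ m = (∀ q → ρ q ≤ m) × ∃ λ q → ρ q ≡ m

module Sem {n : ℕ} (ρ : Fin n → ℕ) where

  Q≤ : ℕ → Subset n
  Q≤ k = tabulate (λ q → ρ q ≤ᵇ k)

  Q= : ℕ → Subset n
  Q= k = tabulate (λ q → ρ q ≡ᵇ k)

  mutual
    D : ℕ → (A : Ty) → Val n A → Set
    D zero    o       x = x ⊆ Q= 0
    D zero    (A ⇒ B) f = MonoMap 0 A B f
    D (suc j) o       x = x ⊆ Q≤ (suc j)
    D (suc j) (A ⇒ B) f = Σ (Val n (A ⇒ B)) (λ f₁ → L j (A ⇒ B) f₁ f)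

    MonoMap : ℕ → (A B : Ty) → Val n (A ⇒ B) → Set
    MonoMap k A B f =
      (∀ x → D k A x → D k B (f x)) ×
      (∀ x y → D k A x → D k A y → Le k A x y → Le k B (f x) (f y))

    Le : ℕ → (A : Ty) → Val n A → Val n A → Set
    Le k o       x y = x ⊆ y
    Le k (A ⇒ B) f g = ∀ x → D k A x → Le k B (f x) (g x)

    -- L j A  is the relation  L^{j+1}_A ⊆ D^j_A × D^{j+1}_A
    L : ℕ → (A : Ty) → Val n A → Val n A → Set
    L j o       r p = D j o r × D (suc j) o p × r ≡ p ∩ Q≤ j
    L j (A ⇒ B) f₁ f₂ =
      D j (A ⇒ B) f₁ × MonoMap (suc j) A B f₂ ×
      (∀ g₁ g₂ → L j A g₁ g₂ → L j B (f₁ g₁) (f₂ g₂))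

  Eq : ℕ → (A : Ty) → Val n A → Val n A → Set
  Eq k o       x y = x ≡ y
  Eq k (A ⇒ B) f g = ∀ x → D k A x → Eq k B (f x) (g x)

  join : (A : Ty) → Val n A → Val n A → Val n A
  join o       x y = x ∪ y
  join (A ⇒ B) f g = λ x → join B (f x) (g x)

  meet : (A : Ty) → Val n A → Val n A → Val n A
  meet o       x y = x ∩ y
  meet (A ⇒ B) f g = λ x → meet B (f x) (g x)

  bar : ℕ → (A : Ty) → Val n A → Val n A
  bar k o       x = x ∩ Q= k
  bar k (A ⇒ B) f = λ e → bar k B (f e)

  IsTop : ℕ → (A : Ty) → Val n A → Set
  IsTop k A t = D k A t × (∀ x → D k A x → Le k A x t)

  -- (j+1 = k)  e is the least element of D^k_A with (d , e) ∈ L^k_A,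
  -- i.e. e = d^{↑⊥}
  IsUpBot : ℕ → (A : Ty) → Val n A → Val n A → Set
  IsUpBot j A d e = L j A d e × (∀ e' → L j A d e' → Le (suc j) A e e')

  IsUpTop : ℕ → (A : Ty) → Val n A → Val n A → Set
  IsUpTop j A d e = L j A d e × (∀ e' → L j A d e' → Le (suc j) A e' e)

-- A value d ∈ D^k_A is determined by its restriction d↓ to ranks ≤ k-1 together with
-- its rank-k part d̄.  Unfolding L^k pointwise down to base type, the two inequalities
-- reduce to subsets of Q: a point of d of rank < k lies in d↓ and hence in every e with
-- (d↓, e) ∈ L, while a point of rank k lies in d̄.  For the second identity, (⊤^{k-1})^{↑⊥}
-- lives on ranks < k (it equals its own truncation, by minimality), so inside d↓^{↑⊤} it
-- only contributes points that d↓ already forces into d.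

module Submission where

open import Defs
open import Data.Nat using (ℕ; suc; _≤_; s≤s)
open import Data.Nat.Properties using (≤ᵇ⇒≤; ≤⇒≤ᵇ; ≡ᵇ⇒≡; ≡⇒≡ᵇ; n≤0⇒n≡0; m≤n⇒m<n∨m≡n)
open import Data.Bool using (Bool; T)
open import Data.Bool.Properties using (T-≡)
open import Data.Fin using (Fin)
open import Data.Fin.Subset using (Subset; _∈_; _∩_)
open import Data.Fin.Subset.Properties
  using (x∈p∩q⁺; x∈p∩q⁻; x∈p∪q⁺; x∈p∪q⁻; ⊆-antisym; p∩q⊆p; p∩q⊆q)
open import Data.Product using (∃; _×_; _,_; proj₁; proj₂)
open import Data.Sum using (_⊎_; inj₁; inj₂)
open import Data.Vec using (tabulate)
open import Data.Vec.Properties using ([]=⇒lookup; lookup⇒[]=; lookup∘tabulate)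
open import Function.Bundles using (Equivalence)
open import Relation.Binary.PropositionalEquality using (_≡_; refl; sym; trans; subst)

∈-tabulate⁻ : ∀ {n} (f : Fin n → Bool) {x : Fin n} → x ∈ tabulate f → T (f x)
∈-tabulate⁻ f {x} x∈ =
  Equivalence.from T-≡ (trans (sym (lookup∘tabulate f x)) ([]=⇒lookup x∈))

∈-tabulate⁺ : ∀ {n} (f : Fin n → Bool) {x : Fin n} → T (f x) → x ∈ tabulate f
∈-tabulate⁺ f {x} fx = lookup⇒[]= x _ (trans (lookup∘tabulate f x) (Equivalence.to T-≡ fx))

≤-suc⇒≤⊎≡ : ∀ {a j} → a ≤ suc j → a ≤ j ⊎ a ≡ suc j
≤-suc⇒≤⊎≡ a≤ with m≤n⇒m<n∨m≡n a≤
... | inj₁ (s≤s a≤j) = inj₁ a≤j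
... | inj₂ a≡       = inj₂ a≡

module Lattice {n : ℕ} (ρ : Fin n → ℕ) where
  open Sem ρ

  ∈Q≤⇒≤ : ∀ {k x} → x ∈ Q≤ k → ρ x ≤ k
  ∈Q≤⇒≤ {k} {x} x∈ = ≤ᵇ⇒≤ (ρ x) k (∈-tabulate⁻ _ x∈)

  ≤⇒∈Q≤ : ∀ {k x} → ρ x ≤ k → x ∈ Q≤ k
  ≤⇒∈Q≤ ρx≤k = ∈-tabulate⁺ _ (≤⇒≤ᵇ ρx≤k)

  ≡⇒∈Q= : ∀ {k x} → ρ x ≡ k → x ∈ Q= k
  ≡⇒∈Q= {k} {x} ρx≡k = ∈-tabulate⁺ _ (≡⇒≡ᵇ (ρ x) k ρx≡k)

  Le-refl : ∀ k A x → Le k A x x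
  Le-refl k o       x x∈ = x∈
  Le-refl k (A ⇒ B) f x _ = Le-refl k B (f x)

  Le-antisym : ∀ k A x y → Le k A x y → Le k A y x → Eq k A x y
  Le-antisym k o       x y x≤y y≤x = ⊆-antisym x≤y y≤x
  Le-antisym k (A ⇒ B) f g f≤g g≤f x x∈D =
    Le-antisym k B (f x) (g x) (f≤g x x∈D) (g≤f x x∈D)

  join-least : ∀ k A a b c → Le k A a c → Le k A b c → Le k A (join A a b) c
  join-least k o a b c a≤c b≤c x∈ with x∈p∪q⁻ a b x∈
  ... | inj₁ x∈a = a≤c x∈a
  ... | inj₂ x∈b = b≤c x∈b
  join-least k (A ⇒ B) a b c a≤c b≤c x x∈D =
    join-least k B (a x) (b x) (c x) (a≤c x x∈D) (b≤c x x∈D)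

  meet-greatest : ∀ k A a b c → Le k A c a → Le k A c b → Le k A c (meet A a b)
  meet-greatest k o a b c c≤a c≤b x∈ = x∈p∩q⁺ (c≤a x∈ , c≤b x∈)
  meet-greatest k (A ⇒ B) a b c c≤a c≤b x x∈D =
    meet-greatest k B (a x) (b x) (c x) (c≤a x x∈D) (c≤b x x∈D)

  bar-≤ : ∀ k k′ A d → Le k A (bar k′ A d) d
  bar-≤ k k′ o       d = p∩q⊆p d _
  bar-≤ k k′ (A ⇒ B) d x _ = bar-≤ k k′ B (d x)

  L⇒D : ∀ j A r p → L j A r p → D j A r
  L⇒D j o       r p = proj₁
  L⇒D j (A ⇒ B) r p = proj₁

  ∩Q≤-∈D : ∀ j (p : Subset n) → D j o (p ∩ Q≤ j)
  ∩Q≤-∈D 0       p x∈ = ≡⇒∈Q= (n≤0⇒n≡0 (∈Q≤⇒≤ (p∩q⊆q p _ x∈)))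
  ∩Q≤-∈D (suc j) p x∈ = p∩q⊆q p _ x∈

  D⇒∃L : ∀ j A x → D (suc j) A x → ∃ λ x↓ → L j A x↓ x
  D⇒∃L j o       x x∈D = x ∩ Q≤ j , ∩Q≤-∈D j x , x∈D , refl
  D⇒∃L j (A ⇒ B) f f∈D = f∈D

  L-≤-join-bar : ∀ j A r p s q → L j A r p → L j A s q → Le j A r s →
                 Le (suc j) A p (join A q (bar (suc j) A p))
  L-≤-join-bar j o _ p _ q (_ , p∈D , refl) (_ , _ , refl) r≤s {x} x∈p
    with ≤-suc⇒≤⊎≡ (∈Q≤⇒≤ (p∈D x∈p))
  ... | inj₁ ρx≤j = x∈p∪q⁺ (inj₁ (p∩q⊆p q _ (r≤s (x∈p∩q⁺ (x∈p , ≤⇒∈Q≤ ρx≤j)))))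
  ... | inj₂ ρx≡k = x∈p∪q⁺ (inj₂ (x∈p∩q⁺ (x∈p , ≡⇒∈Q= ρx≡k)))
  L-≤-join-bar j (A ⇒ B) r p s q (_ , _ , rp) (_ , _ , sq) r≤s x x∈D
    with D⇒∃L j A x x∈D
  ... | x↓ , x↓x = L-≤-join-bar j B (r x↓) (p x) (s x↓) (q x)
                     (rp x↓ x x↓x) (sq x↓ x x↓x) (r≤s x↓ (L⇒D j A x↓ x x↓x))

  trunc : ∀ j A → Val n A → Val n A
  trunc j o       p = p ∩ Q≤ j
  trunc j (A ⇒ B) f = λ x → trunc j B (f x)

  trunc-mono : ∀ j k A x y → Le k A x y → Le k A (trunc j A x) (trunc j A y)
  trunc-mono j k o x y x≤y x∈ with x∈p∩q⁻ x _ x∈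
  ... | x∈x , x∈Q = x∈p∩q⁺ (x≤y x∈x , x∈Q)
  trunc-mono j k (A ⇒ B) f g f≤g x x∈D = trunc-mono j k B (f x) (g x) (f≤g x x∈D)

  mutual
    L-trunc : ∀ j A r p → L j A r p → L j A r (trunc j A p)
    L-trunc j o _ p (r∈D , p∈D , refl) =
      r∈D , (λ x∈ → p∈D (p∩q⊆p p _ x∈)) ,
      ⊆-antisym (λ x∈ → x∈p∩q⁺ (x∈ , p∩q⊆q p _ x∈)) (p∩q⊆p _ _)
    L-trunc j (A ⇒ B) r p (r∈D , (p-D , p-mono) , rp) =
      r∈D ,
      ((λ x x∈D → D-trunc j B (p x) (p-D x x∈D)) ,
       (λ x y x∈D y∈D x≤y → trunc-mono j (suc j) B (p x) (p y) (p-mono x y x∈D y∈D x≤y))) ,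
      (λ g₁ g₂ g₁g₂ → L-trunc j B (r g₁) (p g₂) (rp g₁ g₂ g₁g₂))

    D-trunc : ∀ j A p → D (suc j) A p → D (suc j) A (trunc j A p)
    D-trunc j o       p p∈D x∈ = p∈D (p∩q⊆p p _ x∈)
    D-trunc j (A ⇒ B) p (p↓ , p↓p) = p↓ , L-trunc j (A ⇒ B) p↓ p p↓p

  meet-join-bar-≤ : ∀ j A r h d q → L j A r h → L j A r d →
                    Le (suc j) A q (trunc j A q) →
                    Le (suc j) A (meet A h (join A q (bar (suc j) A d))) d
  meet-join-bar-≤ j o _ h d q (_ , _ , refl) (_ , _ , h↓≡d↓) q≤trunc {x} x∈
    with x∈p∩q⁻ h _ x∈
  ... | x∈h , x∈join with x∈p∪q⁻ q _ x∈join
  ... | inj₂ x∈bar = p∩q⊆p d _ x∈bar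
  ... | inj₁ x∈q   =
    p∩q⊆p d _ (subst (x ∈_) h↓≡d↓ (x∈p∩q⁺ (x∈h , p∩q⊆q q _ (q≤trunc x∈q))))
  meet-join-bar-≤ j (A ⇒ B) r h d q (_ , _ , rh) (_ , _ , rd) q≤trunc x x∈D
    with D⇒∃L j A x x∈D
  ... | x↓ , x↓x = meet-join-bar-≤ j B (r x↓) (h x) (d x) (q x)
                     (rh x↓ x x↓x) (rd x↓ x x↓x) (q≤trunc x x∈D)

lemma4p5 : (n : ℕ) (ρ : Fin n → ℕ) (m : ℕ) → IsMax ρ m →
    (j : ℕ) → suc j ≤ m → (A : Ty) (d : Val n A) → Sem.D ρ (suc j) A d →
    (d↓ : Val n A) → Sem.L ρ j A d↓ d →
    (lo : Val n A) → Sem.IsUpBot ρ j A d↓ lo →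
    (hi : Val n A) → Sem.IsUpTop ρ j A d↓ hi →
    (t : Val n A) → Sem.IsTop ρ j A t →
    (tlo : Val n A) → Sem.IsUpBot ρ j A t tlo →
    Sem.Eq ρ (suc j) A d (Sem.join ρ A lo (Sem.bar ρ (suc j) A d))
    × Sem.Eq ρ (suc j) A d
        (Sem.meet ρ A hi (Sem.join ρ A tlo (Sem.bar ρ (suc j) A d)))
lemma4p5 n ρ _ _ j _ A d _ d↓ d↓d lo (d↓lo , lo-least) hi (d↓hi , hi-greatest)
         t (_ , t-greatest) tlo (t-tlo , tlo-least) =
  Le-antisym k A d _ d≤lo∨bar (join-least k A lo d̄ d (lo-least d d↓d) (bar-≤ k k A d)) ,
  Le-antisym k A d _
    (meet-greatest k A hi _ d (hi-greatest d d↓d) d≤tlo∨bar)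
    (meet-join-bar-≤ j A d↓ hi d tlo d↓hi d↓d tlo≤trunc)
  where
  open Lattice ρ
  k  = suc j
  d̄ = Sem.bar ρ k A d

  d≤lo∨bar : Sem.Le ρ k A d (Sem.join ρ A lo d̄)
  d≤lo∨bar = L-≤-join-bar j A d↓ d d↓ lo d↓d d↓lo (Le-refl j A d↓)

  d≤tlo∨bar : Sem.Le ρ k A d (Sem.join ρ A tlo d̄)
  d≤tlo∨bar = L-≤-join-bar j A d↓ d t tlo d↓d t-tlo (t-greatest d↓ (L⇒D j A d↓ d d↓d))

  tlo≤trunc : Sem.Le ρ k A tlo (trunc j A tlo)
  tlo≤trunc = tlo-least (trunc j A tlo) (L-trunc j A t tlo t-tlo)
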